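{- The sequence $(\Gamma(n,n+1))_{n\ge1}$ is $1,2,1,2,1,2,\ldots$.
   Context: For coprime positive integers $a,b$, consider the equations (E1) $ax+by=\frac{(a-1)(b-1)}{2}$ and (E2) $ax+by+1=\frac{(a-1)(b-1)}{2}$. We say the pair $(a,b)$ uses (E1) if (E1) has a solution in nonnegative integers $x,y$. For arbitrary positive integers $a,b$ with $d=\gcd(a,b)$, define $\Gamma(a,b)=1$ if the coprime pair $(a/d,b/d)$ uses (E1), and $\Gamma(a,b)=2$ otherwise. -}

module Defs where

open import Data.Nat using (ℕ; _+_; _*_; _∸_)
open import Data.Nat.DivMod using (_/_)
open import Data.Nat.Divisibility using (_∣_; quotient)
open import Data.Nat.GCD using (gcd; gcd[m,n]∣m; gcd[m,n]∣n)
open import Data.Product using (∃₂; _×_)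
open import Data.Sum using (_⊎_)
open import Relation.Binary.PropositionalEquality using (_≡_)
open import Relation.Nullary using (¬_)

-- (E1) for a pair (a,b): a x + b y = (a-1)(b-1)/2 has a solution x,y ∈ ℕ.
-- For coprime positive a,b, (a-1)(b-1) is even, so floor division by 2 is exact.
UsesE1 : ℕ → ℕ → Set
UsesE1 a b = ∃₂ λ x y → a * x + b * y ≡ ((a ∸ 1) * (b ∸ 1)) / 2

redL : ℕ → ℕ → ℕ
redL a b = quotient (gcd[m,n]∣m a b)

redR : ℕ → ℕ → ℕ
redR a b = quotient (gcd[m,n]∣n a b)

-- Γ(a,b) = k  (Γ is defined by cases on a proposition, so we give it as a relation).
GammaIs : ℕ → ℕ → ℕ → Set
GammaIs a b k =
    (UsesE1 (redL a b) (redR a b) × k ≡ 1)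
  ⊎ (¬ UsesE1 (redL a b) (redR a b) × k ≡ 2)

{-# OPTIONS --safe #-}
-- For consecutive n, n + 1 the target of (E1) is n(n - 1)/2.  When n = 2m + 1 this is n·m,
-- so x = m, y = 0 solves (E1).  When n = 2m + 2 =: k it is k·m + (m + 1), while
-- k x + (k + 1) y = k (x + y) + y.  Comparing sizes forces x + y ≤ m, hence y < k, and then
-- comparing remainders modulo k gives y = m + 1 > x + y, which is impossible.
module Submission where

open import Defs
open import Data.Nat using (ℕ; suc; _*_; _+_; _∸_; _≤_; _<_; s≤s; NonZero)
open import Data.Nat.Properties
open import Data.Nat.DivMod using (_/_; _%_; m*n/n≡m; [m+kn]%n≡m%n; m<n⇒m%n≡m)
open import Data.Nat.Divisibility using (_∣_; divides; quotient; ∣m+n∣m⇒∣n; ∣1⇒≡1)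
open import Data.Nat.GCD using (gcd; gcd[m,n]∣m; gcd[m,n]∣n)
open import Data.Nat.Coprimality using (coprime⇒gcd≡1)
open import Data.Product using (_×_; _,_)
open import Data.Sum using (inj₁; inj₂)
open import Relation.Binary.PropositionalEquality
open import Relation.Nullary using (¬_)
open import Data.Nat.Tactic.RingSolver using (solve-∀)

gcd[n,1+n]≡1 : ∀ n → gcd n (suc n) ≡ 1
gcd[n,1+n]≡1 n = coprime⇒gcd≡1 {n} {suc n} λ {d} (d∣n , d∣1+n) →
  ∣1⇒≡1 (∣m+n∣m⇒∣n (subst (d ∣_) (+-comm 1 n) d∣1+n) d∣n)

quotient-by-1 : ∀ {d n} (d∣n : d ∣ n) → d ≡ 1 → quotient d∣n ≡ n
quotient-by-1 (divides q n≡q*1) refl = sym (trans n≡q*1 (*-identityʳ q))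

redL-coprime : ∀ {a b} → gcd a b ≡ 1 → redL a b ≡ a
redL-coprime {a} {b} = quotient-by-1 (gcd[m,n]∣m a b)

redR-coprime : ∀ {a b} → gcd a b ≡ 1 → redR a b ≡ b
redR-coprime {a} {b} = quotient-by-1 (gcd[m,n]∣n a b)

GammaIs-coprime-1 : ∀ a b → gcd a b ≡ 1 → UsesE1 a b → GammaIs a b 1
GammaIs-coprime-1 a b gcd≡1 e1 =
  inj₁ (subst₂ UsesE1 (sym (redL-coprime {a} gcd≡1)) (sym (redR-coprime {a} gcd≡1)) e1 , refl)

GammaIs-coprime-2 : ∀ a b → gcd a b ≡ 1 → ¬ UsesE1 a b → GammaIs a b 2
GammaIs-coprime-2 a b gcd≡1 ¬e1 =
  inj₂ ((λ e1 → ¬e1 (subst₂ UsesE1 (redL-coprime {a} gcd≡1) (redR-coprime {a} gcd≡1) e1)) , refl)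

[k*s+y]%k≡y : ∀ k s {y} .{{_ : NonZero k}} → y < k → (k * s + y) % k ≡ y
[k*s+y]%k≡y k s {y} y<k = begin
  (k * s + y) % k ≡⟨ cong (_% k) (trans (+-comm (k * s) y) (cong (y +_) (*-comm k s))) ⟩
  (y + s * k) % k ≡⟨ [m+kn]%n≡m%n y s k ⟩
  y % k           ≡⟨ m<n⇒m%n≡m y<k ⟩
  y               ∎
  where open ≡-Reasoning

remainder-unique : ∀ {k s q y r} → y < k → r < k → k * s + y ≡ k * q + r → y ≡ r
remainder-unique {k@(suc _)} {s} {q} y<k r<k eq =
  trans (sym ([k*s+y]%k≡y k s y<k)) (trans (cong (_% k) eq) ([k*s+y]%k≡y k q r<k))

k*s+y≢k*q+r : ∀ {k s q y r} → q < r → r < k → y ≤ s → k * s + y ≢ k * q + r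
k*s+y≢k*q+r {k} {s} {q} {y} {r} q<r r<k y≤s eq = <⇒≱ q<r r≤q
  where
  open ≤-Reasoning
  s≤q : s ≤ q
  s≤q = ≮⇒≥ λ q<s → <-irrefl (sym eq) (begin-strict
    k * q + r   <⟨ +-monoʳ-< (k * q) r<k ⟩
    k * q + k   ≡⟨ +-comm (k * q) k ⟩
    k + k * q   ≡⟨ *-suc k q ⟨
    k * suc q   ≤⟨ *-monoʳ-≤ k q<s ⟩
    k * s       ≤⟨ m≤m+n (k * s) y ⟩
    k * s + y   ∎)
  y≤q : y ≤ q
  y≤q = ≤-trans y≤s s≤q
  r≤q : r ≤ q
  r≤q = subst (_≤ q) (remainder-unique (<-trans (≤-<-trans y≤q q<r) r<k) r<k eq) y≤q

n+[1+j]∸1≡n+j : ∀ n j → n + suc j ∸ 1 ≡ n + j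
n+[1+j]∸1≡n+j n j = cong (_∸ 1) (+-suc n j)

half-of-double : ∀ {a} b → a ≡ b * 2 → a / 2 ≡ b
half-of-double b refl = m*n/n≡m b 2

target-odd : ∀ m → ((2 * m + 1 ∸ 1) * (2 * m + 2 ∸ 1)) / 2 ≡ (2 * m + 1) * m
target-odd m rewrite n+[1+j]∸1≡n+j (2 * m) 0 | n+[1+j]∸1≡n+j (2 * m) 1 =
  half-of-double ((2 * m + 1) * m) (double m)
  where
  double : ∀ m → (2 * m + 0) * (2 * m + 1) ≡ (2 * m + 1) * m * 2
  double = solve-∀

target-even : ∀ m → ((2 * m + 2 ∸ 1) * (2 * m + 3 ∸ 1)) / 2 ≡ (2 * m + 2) * m + suc m
target-even m rewrite n+[1+j]∸1≡n+j (2 * m) 1 | n+[1+j]∸1≡n+j (2 * m) 2 =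
  half-of-double ((2 * m + 2) * m + suc m) (double m)
  where
  double : ∀ m → (2 * m + 1) * (2 * m + 2) ≡ ((2 * m + 2) * m + suc m) * 2
  double = solve-∀

usesE1-odd : ∀ m → UsesE1 (2 * m + 1) (2 * m + 2)
usesE1-odd m = m , 0 , trans (solution m) (sym (target-odd m))
  where
  solution : ∀ m → (2 * m + 1) * m + (2 * m + 2) * 0 ≡ (2 * m + 1) * m
  solution = solve-∀

¬usesE1-even : ∀ m → ¬ UsesE1 (2 * m + 2) (2 * m + 3)
¬usesE1-even m (x , y , eq) =
  k*s+y≢k*q+r (n<1+n m) m+1<k (m≤n+m y x) (trans (regroup m x y) (trans eq (target-even m)))
  where
  regroup : ∀ m x y → (2 * m + 2) * (x + y) + y ≡ (2 * m + 2) * x + (2 * m + 3) * y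
  regroup = solve-∀
  m+1<k : suc m < 2 * m + 2
  m+1<k = subst (suc m <_) (+-comm 2 (2 * m)) (s≤s (s≤s (m≤m+n m (m + 0))))

lemma4p2 : (m : ℕ) → GammaIs (2 * m + 1) (2 * m + 2) 1 × GammaIs (2 * m + 2) (2 * m + 3) 2
lemma4p2 m = GammaIs-coprime-1 (2 * m + 1) (2 * m + 2) (consecutive-coprime 1) (usesE1-odd m)
           , GammaIs-coprime-2 (2 * m + 2) (2 * m + 3) (consecutive-coprime 2) (¬usesE1-even m)
  where
  consecutive-coprime : ∀ j → gcd (2 * m + j) (2 * m + suc j) ≡ 1
  consecutive-coprime j rewrite +-suc (2 * m) j = gcd[n,1+n]≡1 (2 * m + j)
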